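{- Let $d(n)$ denote the number of maximal independent sets of the diamond cactus $D(n)$. Then $d(1)=2$, $d(2)=4$, $d(3)=7$, and $d(n)=2d(n-1)-d(n-2)+d(n-3)$ for all $n\ge 4$.
   Context: For $n\ge 1$, the diamond (meta-rectangular) cactus $D(n)$ is the graph formed by a chain of $n$ 4-cycles $B_1,\dots,B_n$, where for each $1\le i\le n-1$ the consecutive cycles $B_i$ and $B_{i+1}$ share exactly one vertex, non-consecutive cycles share no vertex, every vertex lies in at most two cycles, and for each $2\le i\le n-1$ the two shared (cut) vertices of $B_i$ are at distance two in $B_i$ (i.e. opposite vertices of the 4-cycle). An independent set is maximal if no further vertex can be added while keeping it independent. -}

module Defs where

open import Data.Nat using (ℕ; zero; suc; _+_; _*_)
open import Data.Nat.Properties using (_≟_)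
open import Data.Fin using (Fin; toℕ)
open import Data.Fin.Subset using (Subset; _∈_; _∉_; _∪_; ⁅_⁆)
open import Data.Fin.Subset.Properties using (_∈?_)
open import Data.Fin.Properties using (all?)
open import Data.Bool using (Bool; true; false)
open import Data.Vec using (_∷_; [])
open import Data.List using (List; []; _∷_; _++_; map; concatMap; upTo; filter; length)
open import Data.Product using (_×_; _,_)
open import Data.Product.Properties using (≡-dec)
open import Data.Sum using (_⊎_)
open import Relation.Nullary using (¬_; Dec; yes; no)
open import Relation.Nullary.Decidable using (_⊎-dec_; _×-dec_; ¬?; _→-dec_)
import Data.List.Membership.DecPropositional as DecMem

record Graph (m : ℕ) : Set₁ where
  field
    Adj  : Fin m → Fin m → Set
    Adj? : ∀ u v → Dec (Adj u v)

module _ {m : ℕ} (G : Graph m) where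
  open Graph G

  Independent : Subset m → Set
  Independent S = ∀ u v → u ∈ S → v ∈ S → ¬ Adj u v

  MaximalIndependent : Subset m → Set
  MaximalIndependent S =
    Independent S × (∀ v → v ∉ S → ¬ Independent (S ∪ ⁅ v ⁆))

  independent? : ∀ S → Dec (Independent S)
  independent? S =
    all? λ u → all? λ v → (u ∈? S) →-dec ((v ∈? S) →-dec ¬? (Adj? u v))

  maximalIndependent? : ∀ S → Dec (MaximalIndependent S)
  maximalIndependent? S =
    independent? S ×-dec
    all? (λ v → ¬? (v ∈? S) →-dec ¬? (independent? (S ∪ ⁅ v ⁆)))

allSubsets : ∀ m → List (Subset m)
allSubsets zero    = [] ∷ []
allSubsets (suc m) = map (true ∷_) (allSubsets m) ++ map (false ∷_) (allSubsets m)

numMIS : ∀ {m} → Graph m → ℕ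
numMIS {m} G = length (filter (maximalIndependent? G) (allSubsets m))

-- With 0-based cycle index i < n, put
--   c_i = 3i,  a_i = 3i+1,  b_i = 3i+2,  (c_n = 3n).
-- Cycle B_{i+1} is the 4-cycle  c_i – a_i – c_{i+1} – b_i – c_i.
-- Consecutive cycles share exactly the cut vertex c_{i+1}, which is
-- opposite to c_i in the cycle, as required.

diamondEdges : ℕ → List (ℕ × ℕ)
diamondEdges n = concatMap cycleEdges (upTo n)
  where
  cycleEdges : ℕ → List (ℕ × ℕ)
  cycleEdges i =
    (3 * i , 3 * i + 1) ∷ (3 * i + 1 , 3 * i + 3) ∷
    (3 * i + 3 , 3 * i + 2) ∷ (3 * i + 2 , 3 * i) ∷ []

open DecMem (≡-dec _≟_ _≟_) using () renaming (_∈_ to _∈ₗ_; _∈?_ to _∈ₗ?_)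

DiamondAdj : (n : ℕ) → Fin (3 * n + 1) → Fin (3 * n + 1) → Set
DiamondAdj n u v =
  ((toℕ u , toℕ v) ∈ₗ diamondEdges n) ⊎ ((toℕ v , toℕ u) ∈ₗ diamondEdges n)

D : (n : ℕ) → Graph (3 * n + 1)
D n = record
  { Adj  = DiamondAdj n
  ; Adj? = λ u v → ((toℕ u , toℕ v) ∈ₗ? diamondEdges n)
                   ⊎-dec ((toℕ v , toℕ u) ∈ₗ? diamondEdges n)
  }

d : ℕ → ℕ
d n = numMIS (D n)

{-# OPTIONS --safe #-}
-- A maximal independent set is an independent dominating set.  Split D(n + 1) into
-- its first diamond c – a – c′ – b – c and a copy of D(n) rooted at c′: a vertex set
-- is maximal independent iff it satisfies a local condition on c, a, b, c′ and its
-- restriction to D(n) is independent and dominating, where c′ counts as dominated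
-- already when a or b is chosen.  Counting such sets of D(n) by the state of the root (chosen;
-- not chosen and not dominated from outside; not chosen but dominated from outside)
-- gives sequences x, y, z with x′ = x + y, y′ = z, z′ = x + z, and d(n) = x(n + 1).
-- Eliminating y and z leaves x(n + 3) + x(n + 1) = 2 x(n + 2) + x(n).
module Submission where

open import Defs
open import Data.Bool using (Bool; true; false; not; _∧_; _∨_; if_then_else_; T; T?)
open import Data.Bool.Properties using (¬-not; T-≡)
open import Data.Empty using (⊥; ⊥-elim)
open import Data.Fin using (Fin; toℕ; fromℕ<) renaming (zero to fzero; suc to fsuc)
open import Data.Fin.Properties using (toℕ<n; toℕ-fromℕ<; any?)
open import Data.Fin.Subset using (Subset; _∈_; _∉_; _∪_; ⁅_⁆)
open import Data.Fin.Subset.Properties using (_∈?_; x∈p∪q⁻; p⊆p∪q; q⊆p∪q; x∈⁅x⁆; x∈⁅y⁆⇒x≡y)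
open import Data.Integer.Properties using (pos-*)
import Data.Integer.Tactic.RingSolver as ℤ-Solver
open import Data.List using (List; []; _∷_; _++_; map; concatMap; upTo; applyUpTo; filter; filterᵇ; length)
open import Data.List.Properties using (map-applyUpTo; concatMap-map; map-concatMap; concatMap-cong; filter-++; length-++; filter-≐)
open import Data.List.Membership.Propositional using () renaming (_∈_ to _∈ₗ_)
open import Data.List.Membership.Propositional.Properties using (∈-++⁻; ∈-++⁺ˡ; ∈-++⁺ʳ; ∈-map⁻; ∈-map⁺)
open import Data.List.Relation.Unary.Any using (here; there)
open import Data.Nat using (ℕ; zero; suc; _∸_; _≤_; _<_; z≤n; s≤s)
import Data.Nat as ℕ
open import Data.Nat.Properties using (<⇒≤; *-suc; +-comm; +-identityʳ; ≤-trans; ≤-refl; m≤m+n; +-monoʳ-≤; +-cancelˡ-≤; m<1+n⇒m≤n)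
import Data.Nat.Tactic.RingSolver as ℕ-Solver
open import Data.Product using (Σ-syntax; ∃-syntax; _×_; _,_)
open import Data.Sum using (_⊎_; inj₁; inj₂; [_,_]′)
import Data.Sum as Sum
open import Data.Vec using (lookup; []; _∷_)
open import Data.Vec.Properties using ([]=⇒lookup; lookup⇒[]=)
open import Function using (id; _∘_; const; flip)
open import Function.Bundles using (_⇔_; mk⇔; Equivalence)
open import Relation.Binary.Definitions using (Symmetric)
open import Relation.Binary.PropositionalEquality using (_≡_; refl; sym; trans; cong; cong₂; subst; module ≡-Reasoning)
open import Relation.Nullary using (¬_; yes; no; does)
open import Relation.Unary using (Decidable)
open import Relation.Nullary.Decidable using (_×-dec_)
open import Function.Properties.Equivalence using () renaming (trans to ⇔-trans; sym to ⇔-sym)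
open Equivalence using (to; from)

-- Natural-number + and * are in scope only inside this module: the theorem at the end
-- uses the integer operators under the same names.
module _ where
  open import Data.Nat using (_+_; _*_)

  module _ {m : ℕ} (G : Graph m) where
    open Graph G

    Dominating : Subset m → Set
    Dominating S = ∀ v → v ∉ S → ∃[ u ] u ∈ S × Adj u v

    ∪-⁅⁆-independent : Symmetric Adj → (∀ {v} → ¬ Adj v v) → ∀ {S v} →
      Independent G S → (∀ u → u ∈ S → ¬ Adj u v) → Independent G (S ∪ ⁅ v ⁆)
    ∪-⁅⁆-independent adj-sym irrefl {S} {v} ind isolated x y x∈ y∈ x~y
      with x∈p∪q⁻ S ⁅ v ⁆ x∈ | x∈p∪q⁻ S ⁅ v ⁆ y∈
    ... | inj₁ x∈S | inj₁ y∈S = ind x y x∈S y∈S x~y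
    ... | inj₁ x∈S | inj₂ y∈v rewrite x∈⁅y⁆⇒x≡y v y∈v = isolated x x∈S x~y
    ... | inj₂ x∈v | inj₁ y∈S rewrite x∈⁅y⁆⇒x≡y v x∈v = isolated y y∈S (adj-sym x~y)
    ... | inj₂ x∈v | inj₂ y∈v rewrite x∈⁅y⁆⇒x≡y v x∈v | x∈⁅y⁆⇒x≡y v y∈v = irrefl x~y

    maximal⇔dominating : Symmetric Adj → (∀ {v} → ¬ Adj v v) → ∀ S →
      MaximalIndependent G S ⇔ (Independent G S × Dominating S)
    maximal⇔dominating adj-sym irrefl S = mk⇔
      (λ (ind , maximal) → ind , dominating ind maximal)
      (λ (ind , dom) → ind , maximal dom)
      where
      dominating : Independent G S → (∀ v → v ∉ S → ¬ Independent G (S ∪ ⁅ v ⁆)) → Dominating S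
      dominating ind max v v∉S with any? (λ u → (u ∈? S) ×-dec Adj? u v)
      ... | yes neighbour = neighbour
      ... | no none = ⊥-elim (max v v∉S
              (∪-⁅⁆-independent adj-sym irrefl ind λ u u∈S u~v → none (u , u∈S , u~v)))
      maximal : Dominating S → ∀ v → v ∉ S → ¬ Independent G (S ∪ ⁅ v ⁆)
      maximal dom v v∉S ind with dom v v∉S
      ... | u , u∈S , u~v = ind u v (p⊆p∪q ⁅ v ⁆ u∈S) (q⊆p∪q S ⁅ v ⁆ (x∈⁅x⁆ v)) u~v

  -- The local function of diamondEdges, which is not exported.
  cycleEdges : ℕ → List (ℕ × ℕ)
  cycleEdges i =
    (3 * i , 3 * i + 1) ∷ (3 * i + 1 , 3 * i + 3) ∷
    (3 * i + 3 , 3 * i + 2) ∷ (3 * i + 2 , 3 * i) ∷ []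

  shift3 : ℕ × ℕ → ℕ × ℕ
  shift3 (x , y) = 3 + x , 3 + y

  cycleEdges-suc : ∀ i → cycleEdges (suc i) ≡ map shift3 (cycleEdges i)
  cycleEdges-suc i = cong diamondAt (*-suc 3 i)
    where
    diamondAt : ℕ → List (ℕ × ℕ)
    diamondAt k = (k , k + 1) ∷ (k + 1 , k + 3) ∷ (k + 3 , k + 2) ∷ (k + 2 , k) ∷ []

  diamondEdges-suc : ∀ n → diamondEdges (suc n) ≡ cycleEdges 0 ++ map shift3 (diamondEdges n)
  diamondEdges-suc n = cong (cycleEdges 0 ++_) (begin
    concatMap cycleEdges (applyUpTo suc n)                ≡⟨ cong (concatMap cycleEdges) (sym (map-applyUpTo id suc n)) ⟩
    concatMap cycleEdges (map suc (upTo n))               ≡⟨ concatMap-map cycleEdges suc (upTo n) ⟩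
    concatMap (cycleEdges ∘ suc) (upTo n)                 ≡⟨ concatMap-cong cycleEdges-suc (upTo n) ⟩
    concatMap (map shift3 ∘ cycleEdges) (upTo n)          ≡⟨ sym (map-concatMap shift3 cycleEdges (upTo n)) ⟩
    map shift3 (diamondEdges n)                           ∎)
    where open ≡-Reasoning

  data Adjacent (n x y : ℕ) : Set where
    forward  : (x , y) ∈ₗ diamondEdges n → Adjacent n x y
    backward : (y , x) ∈ₗ diamondEdges n → Adjacent n x y

  adjacent-sym : ∀ {n} → Symmetric (Adjacent n)
  adjacent-sym (forward xy)  = backward xy
  adjacent-sym (backward yx) = forward yx

  diamondAdj⇔adjacent : ∀ {n u v} → DiamondAdj n u v ⇔ Adjacent n (toℕ u) (toℕ v)
  diamondAdj⇔adjacent = mk⇔ [ forward , backward ]′ λ where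
    (forward uv)  → inj₁ uv
    (backward vu) → inj₂ vu

  -- The first diamond of D(n + 1) is c – a – c′ – b – c with c = 0, a = 1, b = 2
  -- and c′ = 3; the remaining diamonds form a copy of D(n) shifted by 3.
  data AdjacentView (n : ℕ) : ℕ → ℕ → Set where
    c-a  : AdjacentView n 0 1
    a-c  : AdjacentView n 1 0
    a-c′ : AdjacentView n 1 3
    c′-a : AdjacentView n 3 1
    c′-b : AdjacentView n 3 2
    b-c′ : AdjacentView n 2 3
    b-c  : AdjacentView n 2 0
    c-b  : AdjacentView n 0 2
    shifted : ∀ {x y} → Adjacent n x y → AdjacentView n (3 + x) (3 + y)

  view-sym : ∀ {n x y} → AdjacentView n x y → AdjacentView n y x
  view-sym c-a  = a-c
  view-sym a-c  = c-a
  view-sym a-c′ = c′-a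
  view-sym c′-a = a-c′
  view-sym c′-b = b-c′
  view-sym b-c′ = c′-b
  view-sym b-c  = c-b
  view-sym c-b  = b-c
  view-sym (shifted x~y) = shifted (adjacent-sym x~y)

  view : ∀ {n x y} → Adjacent (suc n) x y → AdjacentView n x y
  view {n} {x} {y} (forward xy) = edgeView (subst ((x , y) ∈ₗ_) (diamondEdges-suc n) xy)
    where
    edgeView : ∀ {x y} → (x , y) ∈ₗ cycleEdges 0 ++ map shift3 (diamondEdges n) → AdjacentView n x y
    edgeView e with ∈-++⁻ (cycleEdges 0) e
    ... | inj₁ (here refl)                         = c-a
    ... | inj₁ (there (here refl))                 = a-c′
    ... | inj₁ (there (there (here refl)))         = c′-b
    ... | inj₁ (there (there (there (here refl)))) = b-c
    ... | inj₂ e′ with ∈-map⁻ shift3 e′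
    ...   | (_ , _) , xy , refl = shifted (forward xy)
  view (backward yx) = view-sym (view (forward yx))

  first-edge : ∀ {n e} → e ∈ₗ cycleEdges 0 → e ∈ₗ diamondEdges (suc n)
  first-edge {n} {e} e∈ = subst (e ∈ₗ_) (sym (diamondEdges-suc n)) (∈-++⁺ˡ {ys = map shift3 (diamondEdges n)} e∈)

  shifted-edge : ∀ {n e} → e ∈ₗ diamondEdges n → shift3 e ∈ₗ diamondEdges (suc n)
  shifted-edge {n} {e} e∈ =
    subst (shift3 e ∈ₗ_) (sym (diamondEdges-suc n)) (∈-++⁺ʳ (cycleEdges 0) (∈-map⁺ shift3 e∈))

  unview : ∀ {n x y} → AdjacentView n x y → Adjacent (suc n) x y
  unview {n} c-a  = forward (first-edge {n} (here refl))
  unview {n} a-c′ = forward (first-edge {n} (there (here refl)))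
  unview {n} c′-b = forward (first-edge {n} (there (there (here refl))))
  unview {n} b-c  = forward (first-edge {n} (there (there (there (here refl)))))
  unview a-c  = adjacent-sym (unview c-a)
  unview c′-a = adjacent-sym (unview a-c′)
  unview b-c′ = adjacent-sym (unview c′-b)
  unview c-b  = adjacent-sym (unview b-c)
  unview {n} (shifted (forward xy))  = forward (shifted-edge {n} xy)
  unview {n} (shifted (backward yx)) = backward (shifted-edge {n} yx)

  ≤3⇒≤3*suc : ∀ n {v} → v ≤ 3 → v ≤ 3 * suc n
  ≤3⇒≤3*suc n {v} v≤3 = subst (v ≤_) (sym (*-suc 3 n)) (≤-trans v≤3 (m≤m+n 3 (3 * n)))

  3+≤3*suc⇔≤3* : ∀ n {v} → 3 + v ≤ 3 * suc n ⇔ v ≤ 3 * n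
  3+≤3*suc⇔≤3* n {v} rewrite *-suc 3 n = mk⇔ (+-cancelˡ-≤ 3 v (3 * n)) (+-monoʳ-≤ 3)

  adjacent⇒≤ : ∀ {n x y} → Adjacent n x y → x ≤ 3 * n
  adjacent⇒≤ {zero} (forward ())
  adjacent⇒≤ {zero} (backward ())
  adjacent⇒≤ {suc n} x~y with view x~y
  ... | c-a  = z≤n
  ... | c-b  = z≤n
  ... | a-c  = ≤3⇒≤3*suc n (s≤s z≤n)
  ... | a-c′ = ≤3⇒≤3*suc n (s≤s z≤n)
  ... | b-c  = ≤3⇒≤3*suc n (s≤s (s≤s z≤n))
  ... | b-c′ = ≤3⇒≤3*suc n (s≤s (s≤s z≤n))
  ... | c′-a = ≤3⇒≤3*suc n ≤-refl
  ... | c′-b = ≤3⇒≤3*suc n ≤-refl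
  ... | shifted x~y′ = from (3+≤3*suc⇔≤3* n) (adjacent⇒≤ x~y′)

  adjacent-irrefl : ∀ {n x} → ¬ Adjacent n x x
  adjacent-irrefl {zero} (forward ())
  adjacent-irrefl {zero} (backward ())
  adjacent-irrefl {suc n} x~x with view x~x
  ... | shifted x~x′ = adjacent-irrefl x~x′

  ∧-intro : ∀ {x y} → x ≡ true → y ≡ true → x ∧ y ≡ true
  ∧-intro refl refl = refl

  ∧-elim : ∀ x {y} → x ∧ y ≡ true → x ≡ true × y ≡ true
  ∧-elim true y≡true = refl , y≡true

  ∨-intro : ∀ x {y} → x ≡ true ⊎ y ≡ true → x ∨ y ≡ true
  ∨-intro true  _             = refl
  ∨-intro false (inj₂ y≡true) = y≡true

  ∨-elim : ∀ x {y} → x ∨ y ≡ true → x ≡ true ⊎ y ≡ true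
  ∨-elim true  _      = inj₁ refl
  ∨-elim false y≡true = inj₂ y≡true

  ⇒-intro : ∀ x {y} → (x ≡ false → y ≡ true) → x ∨ y ≡ true
  ⇒-intro true  _ = refl
  ⇒-intro false f = f refl

  ⇒-elim : ∀ {x y} → x ∨ y ≡ true → x ≡ false → y ≡ true
  ⇒-elim y≡true refl = y≡true

  nand-intro : ∀ x y → (x ≡ true → y ≡ true → ⊥) → not (x ∧ y) ≡ true
  nand-intro true  true  f = ⊥-elim (f refl refl)
  nand-intro true  false _ = refl
  nand-intro false _     _ = refl

  nand-elim : ∀ {x y} → not (x ∧ y) ≡ true → x ≡ true → y ≡ true → ⊥
  nand-elim () refl refl

  -- A configuration s : ℕ → Bool describes a vertex set of D(n); the flag covered
  -- says that vertex 0 is dominated from outside D(n).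
  Independentℕ : ℕ → (ℕ → Bool) → Set
  Independentℕ n s = ∀ {x y} → Adjacent n x y → s x ≡ true → s y ≡ true → ⊥

  Dominatingℕ : ℕ → Bool → (ℕ → Bool) → Set
  Dominatingℕ n covered s = ∀ v → v ≤ 3 * n → s v ≡ false →
    (v ≡ 0 × covered ≡ true) ⊎ ∃[ u ] Adjacent n u v × s u ≡ true

  drop3 : (ℕ → Bool) → ℕ → Bool
  drop3 s i = s (3 + i)

  diamondOKᵇ : (covered c a b c′ : Bool) → Bool
  diamondOKᵇ covered c a b c′ =
    not (c ∧ a) ∧ not (c ∧ b) ∧ not (a ∧ c′) ∧ not (b ∧ c′) ∧
    (a ∨ c ∨ c′) ∧ (b ∨ c ∨ c′) ∧ (c ∨ covered ∨ a ∨ b)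

  record DiamondOK (covered c a b c′ : Bool) : Set where
    field
      c≁a  : c ≡ true → a ≡ true → ⊥
      c≁b  : c ≡ true → b ≡ true → ⊥
      a≁c′ : a ≡ true → c′ ≡ true → ⊥
      b≁c′ : b ≡ true → c′ ≡ true → ⊥
      a-dominated : a ≡ false → c ≡ true ⊎ c′ ≡ true
      b-dominated : b ≡ false → c ≡ true ⊎ c′ ≡ true
      c-dominated : c ≡ false → covered ≡ true ⊎ a ≡ true ⊎ b ≡ true

  DiamondOK⇒diamondOKᵇ : ∀ {covered c a b c′} → DiamondOK covered c a b c′ → diamondOKᵇ covered c a b c′ ≡ true
  DiamondOK⇒diamondOKᵇ {covered} {c} {a} {b} {c′} ok =
    ∧-intro (nand-intro c a c≁a) (∧-intro (nand-intro c b c≁b) (∧-intro (nand-intro a c′ a≁c′)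
      (∧-intro (nand-intro b c′ b≁c′) (∧-intro (⇒-intro a (∨-intro c ∘ a-dominated))
      (∧-intro (⇒-intro b (∨-intro c ∘ b-dominated))
        (⇒-intro c (∨-intro covered ∘ Sum.map₂ (∨-intro a) ∘ c-dominated)))))))
    where open DiamondOK ok

  diamondOKᵇ⇒DiamondOK : ∀ {covered c a b c′} → diamondOKᵇ covered c a b c′ ≡ true → DiamondOK covered c a b c′
  diamondOKᵇ⇒DiamondOK {covered} {c} {a} {b} {c′} ok
    with c≁a , ok ← ∧-elim (not (c ∧ a)) ok
    with c≁b , ok ← ∧-elim (not (c ∧ b)) ok
    with a≁c′ , ok ← ∧-elim (not (a ∧ c′)) ok
    with b≁c′ , ok ← ∧-elim (not (b ∧ c′)) ok
    with a-dom , ok ← ∧-elim (a ∨ c ∨ c′) ok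
    with b-dom , c-dom ← ∧-elim (b ∨ c ∨ c′) ok = record
      { c≁a  = nand-elim c≁a
      ; c≁b  = nand-elim c≁b
      ; a≁c′ = nand-elim a≁c′
      ; b≁c′ = nand-elim b≁c′
      ; a-dominated = ∨-elim c ∘ ⇒-elim a-dom
      ; b-dominated = ∨-elim c ∘ ⇒-elim b-dom
      ; c-dominated = Sum.map₂ (∨-elim a) ∘ ∨-elim covered ∘ ⇒-elim c-dom
      }

  isMISᵇ : ℕ → Bool → (ℕ → Bool) → Bool
  isMISᵇ zero    covered s = s 0 ∨ covered
  isMISᵇ (suc n) covered s =
    diamondOKᵇ covered (s 0) (s 1) (s 2) (s 3) ∧ isMISᵇ n (s 1 ∨ s 2) (drop3 s)

  firstDiamondOK : ∀ {n covered s} → Independentℕ (suc n) s → Dominatingℕ (suc n) covered s →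
    DiamondOK covered (s 0) (s 1) (s 2) (s 3)
  firstDiamondOK {n} {covered} {s} ind dom = record
    { c≁a  = ind (unview c-a)
    ; c≁b  = ind (unview c-b)
    ; a≁c′ = ind (unview a-c′)
    ; b≁c′ = ind (unview b-c′)
    ; a-dominated = a-dominated
    ; b-dominated = b-dominated
    ; c-dominated = c-dominated
    }
    where
    dominator : ∀ v → v ≤ 3 → s v ≡ false →
      (v ≡ 0 × covered ≡ true) ⊎ ∃[ u ] AdjacentView n u v × s u ≡ true
    dominator v v≤3 sv = Sum.map₂ (λ (u , u~v , su) → u , view u~v , su) (dom v (≤3⇒≤3*suc n v≤3) sv)

    a-dominated : s 1 ≡ false → s 0 ≡ true ⊎ s 3 ≡ true
    a-dominated sa with dominator 1 (s≤s z≤n) sa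
    ... | inj₁ (() , _)
    ... | inj₂ (_ , c-a , sc)   = inj₁ sc
    ... | inj₂ (_ , c′-a , sc′) = inj₂ sc′

    b-dominated : s 2 ≡ false → s 0 ≡ true ⊎ s 3 ≡ true
    b-dominated sb with dominator 2 (s≤s (s≤s z≤n)) sb
    ... | inj₁ (() , _)
    ... | inj₂ (_ , c-b , sc)   = inj₁ sc
    ... | inj₂ (_ , c′-b , sc′) = inj₂ sc′

    c-dominated : s 0 ≡ false → covered ≡ true ⊎ s 1 ≡ true ⊎ s 2 ≡ true
    c-dominated sc with dominator 0 z≤n sc
    ... | inj₁ (_ , cov)      = inj₁ cov
    ... | inj₂ (_ , a-c , sa) = inj₂ (inj₁ sa)
    ... | inj₂ (_ , b-c , sb) = inj₂ (inj₂ sb)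

  independent-drop3 : ∀ {n s} → Independentℕ (suc n) s → Independentℕ n (drop3 s)
  independent-drop3 ind x~y = ind (unview (shifted x~y))

  dominating-drop3 : ∀ {n covered s} → Dominatingℕ (suc n) covered s → Dominatingℕ n (s 1 ∨ s 2) (drop3 s)
  dominating-drop3 {n} {s = s} dom v v≤3n sv with dom (3 + v) (from (3+≤3*suc⇔≤3* n) v≤3n) sv
  ... | inj₂ (_ , u~v , su) with view u~v
  ...   | a-c′ = inj₁ (refl , ∨-intro (s 1) (inj₁ su))
  ...   | b-c′ = inj₁ (refl , ∨-intro (s 1) (inj₂ su))
  ...   | shifted u~v′ = inj₂ (_ , u~v′ , su)

  module _ {n : ℕ} {covered : Bool} {s : ℕ → Bool} (ok : DiamondOK covered (s 0) (s 1) (s 2) (s 3)) where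
    open DiamondOK ok

    independent-extend : Independentℕ n (drop3 s) → Independentℕ (suc n) s
    independent-extend ind x~y with view x~y
    ... | c-a  = c≁a
    ... | a-c  = flip c≁a
    ... | c-b  = c≁b
    ... | b-c  = flip c≁b
    ... | a-c′ = a≁c′
    ... | c′-a = flip a≁c′
    ... | b-c′ = b≁c′
    ... | c′-b = flip b≁c′
    ... | shifted x~y′ = ind x~y′

    dominating-extend : Dominatingℕ n (s 1 ∨ s 2) (drop3 s) → Dominatingℕ (suc n) covered s
    dominating-extend _ 0 _ sc with c-dominated sc
    ... | inj₁ cov        = inj₁ (refl , cov)
    ... | inj₂ (inj₁ sa) = inj₂ (1 , unview a-c , sa)
    ... | inj₂ (inj₂ sb) = inj₂ (2 , unview b-c , sb)
    dominating-extend _ 1 _ sa with a-dominated sa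
    ... | inj₁ sc  = inj₂ (0 , unview c-a , sc)
    ... | inj₂ sc′ = inj₂ (3 , unview c′-a , sc′)
    dominating-extend _ 2 _ sb with b-dominated sb
    ... | inj₁ sc  = inj₂ (0 , unview c-b , sc)
    ... | inj₂ sc′ = inj₂ (3 , unview c′-b , sc′)
    dominating-extend dom (suc (suc (suc v))) v≤ sv with dom v (to (3+≤3*suc⇔≤3* n) v≤) sv
    ... | inj₂ (u , u~v , su) = inj₂ (3 + u , unview (shifted u~v) , su)
    ... | inj₁ (refl , ab) with ∨-elim (s 1) ab
    ...   | inj₁ sa = inj₂ (1 , unview a-c′ , sa)
    ...   | inj₂ sb = inj₂ (2 , unview b-c′ , sb)

  isMISᵇ-complete : ∀ n {covered s} → Independentℕ n s → Dominatingℕ n covered s → isMISᵇ n covered s ≡ true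
  isMISᵇ-complete zero {covered} {s} _ dom = ⇒-intro (s 0) covered-if-absent
    where
    covered-if-absent : s 0 ≡ false → covered ≡ true
    covered-if-absent sc with dom 0 z≤n sc
    ... | inj₁ (_ , cov)              = cov
    ... | inj₂ (_ , forward () , _)
    ... | inj₂ (_ , backward () , _)
  isMISᵇ-complete (suc n) ind dom =
    ∧-intro (DiamondOK⇒diamondOKᵇ (firstDiamondOK ind dom))
            (isMISᵇ-complete n (independent-drop3 ind) (dominating-drop3 dom))

  isMISᵇ-sound : ∀ n {covered s} → isMISᵇ n covered s ≡ true → Independentℕ n s × Dominatingℕ n covered s
  isMISᵇ-sound zero ok = (λ { (forward ()) ; (backward ()) }) , λ where
    zero _ sc → inj₁ (refl , ⇒-elim ok sc)
  isMISᵇ-sound (suc n) {covered} {s} ok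
    with first , rest ← ∧-elim (diamondOKᵇ covered (s 0) (s 1) (s 2) (s 3)) ok
    with ind , dom ← isMISᵇ-sound n rest =
    let firstOK = diamondOKᵇ⇒DiamondOK {covered} first in
    independent-extend {n} {s = s} firstOK ind , dominating-extend {n} firstOK dom

  infixr 5 _◂_
  _◂_ : Bool → (ℕ → Bool) → ℕ → Bool
  (b ◂ s) zero    = b
  (b ◂ s) (suc i) = s i

  indicator : ∀ {m} → Subset m → ℕ → Bool
  indicator []      = const false
  indicator (b ∷ S) = b ◂ indicator S

  indicator-lookup : ∀ {m} (S : Subset m) i → indicator S (toℕ i) ≡ lookup S i
  indicator-lookup (_ ∷ _) fzero    = refl
  indicator-lookup (_ ∷ S) (fsuc i) = indicator-lookup S i

  ∈⇒indicator : ∀ {m} {S : Subset m} {i} → i ∈ S → indicator S (toℕ i) ≡ true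
  ∈⇒indicator {S = S} {i} i∈S = trans (indicator-lookup S i) ([]=⇒lookup i∈S)

  indicator⇒∈ : ∀ {m} {S : Subset m} {i} → indicator S (toℕ i) ≡ true → i ∈ S
  indicator⇒∈ {S = S} {i} Si = lookup⇒[]= i S (trans (sym (indicator-lookup S i)) Si)

  ∉⇒indicator : ∀ {m} {S : Subset m} {i} → i ∉ S → indicator S (toℕ i) ≡ false
  ∉⇒indicator i∉S = ¬-not (i∉S ∘ indicator⇒∈)

  indicator⇒∉ : ∀ {m} {S : Subset m} {i} → indicator S (toℕ i) ≡ false → i ∉ S
  indicator⇒∉ Si i∈S with () ← trans (sym Si) (∈⇒indicator i∈S)

  vertexAt : ∀ {n x} → x ≤ 3 * n → Σ[ v ∈ Fin (3 * n + 1) ] toℕ v ≡ x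
  vertexAt {n} {x} x≤3n = fromℕ< x< , toℕ-fromℕ< x<
    where
    x< : x < 3 * n + 1
    x< = subst (x <_) (+-comm 1 (3 * n)) (s≤s x≤3n)

  toℕ≤3n : ∀ {n} (v : Fin (3 * n + 1)) → toℕ v ≤ 3 * n
  toℕ≤3n {n} v = m<1+n⇒m≤n (subst (toℕ v <_) (+-comm (3 * n) 1) (toℕ<n v))

  module _ {n : ℕ} {S : Subset (3 * n + 1)} where

    independent⇒Independentℕ : Independent (D n) S → Independentℕ n (indicator S)
    independent⇒Independentℕ ind {x} {y} x~y Sx Sy
      with u , refl ← vertexAt {n} (adjacent⇒≤ x~y)
      with v , refl ← vertexAt {n} (adjacent⇒≤ (adjacent-sym x~y)) =
      ind u v (indicator⇒∈ Sx) (indicator⇒∈ Sy) (from diamondAdj⇔adjacent x~y)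

    Independentℕ⇒independent : Independentℕ n (indicator S) → Independent (D n) S
    Independentℕ⇒independent ind u v u∈S v∈S u~v =
      ind (to diamondAdj⇔adjacent u~v) (∈⇒indicator u∈S) (∈⇒indicator v∈S)

    dominating⇒Dominatingℕ : Dominating (D n) S → Dominatingℕ n false (indicator S)
    dominating⇒Dominatingℕ dom x x≤3n Sx
      with v , refl ← vertexAt {n} x≤3n
      with u , u∈S , u~v ← dom v (indicator⇒∉ Sx) =
      inj₂ (toℕ u , to diamondAdj⇔adjacent u~v , ∈⇒indicator u∈S)

    Dominatingℕ⇒dominating : Dominatingℕ n false (indicator S) → Dominating (D n) S
    Dominatingℕ⇒dominating dom v v∉S with dom (toℕ v) (toℕ≤3n {n} v) (∉⇒indicator v∉S)
    ... | inj₂ (x , x~v , Sx) with u , refl ← vertexAt {n} (adjacent⇒≤ x~v) =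
      u , indicator⇒∈ Sx , from diamondAdj⇔adjacent x~v

  maximalIndependent⇔isMISᵇ : ∀ n (S : Subset (3 * n + 1)) →
    MaximalIndependent (D n) S ⇔ isMISᵇ n false (indicator S) ≡ true
  maximalIndependent⇔isMISᵇ n S = mk⇔
    (λ mis → let ind , dom = to maximal⇔ mis in
      isMISᵇ-complete n (independent⇒Independentℕ ind) (dominating⇒Dominatingℕ dom))
    (λ ok → let ind , dom = isMISᵇ-sound n ok in
      from maximal⇔ (Independentℕ⇒independent ind , Dominatingℕ⇒dominating dom))
    where
    maximal⇔ : MaximalIndependent (D n) S ⇔ (Independent (D n) S × Dominating (D n) S)
    maximal⇔ = maximal⇔dominating (D n) Sum.swap (adjacent-irrefl {n} ∘ to diamondAdj⇔adjacent) S

  sumBool : (Bool → ℕ) → ℕ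
  sumBool f = f true + f false

  sumBool-cong : ∀ {f g : Bool → ℕ} → (∀ b → f b ≡ g b) → sumBool f ≡ sumBool g
  sumBool-cong f≗g = cong₂ _+_ (f≗g true) (f≗g false)

  count : ℕ → ((ℕ → Bool) → Bool) → ℕ
  count zero    g = if g (const false) then 1 else 0
  count (suc m) g = sumBool λ b → count m (λ s → g (b ◂ s))

  count-false : ∀ m → count m (const false) ≡ 0
  count-false zero    = refl
  count-false (suc m) = cong₂ _+_ (count-false m) (count-false m)

  count-∧ : ∀ m b g → count m (λ s → b ∧ g s) ≡ (if b then count m g else 0)
  count-∧ m true  g = refl
  count-∧ m false g = count-false m

  length-filter-map : ∀ {A B : Set} {P : A → Set} (P? : Decidable P) (f : B → A) xs →
    length (filter P? (map f xs)) ≡ length (filter (P? ∘ f) xs)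
  length-filter-map P? f [] = refl
  length-filter-map P? f (x ∷ xs) with does (P? (f x))
  ... | true  = cong suc (length-filter-map P? f xs)
  ... | false = length-filter-map P? f xs

  length-filterᵇ-allSubsets : ∀ m g → length (filterᵇ (g ∘ indicator) (allSubsets m)) ≡ count m g
  length-filterᵇ-allSubsets zero g with g (const false)
  ... | true  = refl
  ... | false = refl
  length-filterᵇ-allSubsets (suc m) g = begin
    length (filterᵇ p (map (true ∷_) subsets ++ map (false ∷_) subsets))
      ≡⟨ cong length (filter-++ (T? ∘ p) (map (true ∷_) subsets) (map (false ∷_) subsets)) ⟩
    length (filterᵇ p (map (true ∷_) subsets) ++ filterᵇ p (map (false ∷_) subsets))
      ≡⟨ length-++ (filterᵇ p (map (true ∷_) subsets)) ⟩
    length (filterᵇ p (map (true ∷_) subsets)) + length (filterᵇ p (map (false ∷_) subsets))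
      ≡⟨ sumBool-cong (λ b → trans (length-filter-map (T? ∘ p) (b ∷_) subsets)
                                   (length-filterᵇ-allSubsets m (λ s → g (b ◂ s)))) ⟩
    count (suc m) g ∎
    where
    open ≡-Reasoning
    p : Subset (suc m) → Bool
    p = g ∘ indicator
    subsets : List (Subset m)
    subsets = allSubsets m

  misCount : ℕ → Bool → Bool → ℕ
  misCount n covered c = count (3 * n) (λ s → isMISᵇ n covered (c ◂ s))

  misCount-suc : ∀ n covered c → misCount (suc n) covered c ≡
    sumBool λ a → sumBool λ b → sumBool λ c′ →
      if diamondOKᵇ covered c a b c′ then misCount n (a ∨ b) c′ else 0
  misCount-suc n covered c = begin
    count (3 * suc n) (λ s → isMISᵇ (suc n) covered (c ◂ s))
      ≡⟨ cong (λ m → count m (λ s → isMISᵇ (suc n) covered (c ◂ s))) (*-suc 3 n) ⟩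
    count (3 + 3 * n) (λ s → isMISᵇ (suc n) covered (c ◂ s))
      ≡⟨ sumBool-cong (λ a → sumBool-cong λ b → sumBool-cong λ c′ →
           count-∧ (3 * n) (diamondOKᵇ covered c a b c′) (λ s → isMISᵇ n (a ∨ b) (c′ ◂ s))) ⟩
    (sumBool λ a → sumBool λ b → sumBool λ c′ →
      if diamondOKᵇ covered c a b c′ then misCount n (a ∨ b) c′ else 0) ∎
    where open ≡-Reasoning

  withRoot withoutRoot coveredRoot : ℕ → ℕ
  withRoot    n = misCount n false true
  withoutRoot n = misCount n false false
  coveredRoot n = misCount n true false

  withRoot-suc : ∀ n → withRoot (suc n) ≡ withRoot n + withoutRoot n
  withRoot-suc n = misCount-suc n false true

  withoutRoot-suc : ∀ n → withoutRoot (suc n) ≡ coveredRoot n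
  withoutRoot-suc n = begin
    withoutRoot (suc n)       ≡⟨ misCount-suc n false false ⟩
    coveredRoot n + 0 + 0     ≡⟨ +-identityʳ (coveredRoot n + 0) ⟩
    coveredRoot n + 0         ≡⟨ +-identityʳ (coveredRoot n) ⟩
    coveredRoot n             ∎
    where open ≡-Reasoning

  coveredRoot-suc : ∀ n → coveredRoot (suc n) ≡ withRoot n + coveredRoot n
  coveredRoot-suc n = begin
    coveredRoot (suc n)                   ≡⟨ misCount-suc n true false ⟩
    (coveredRoot n + 0) + (withRoot n + 0) ≡⟨ cong₂ _+_ (+-identityʳ (coveredRoot n)) (+-identityʳ (withRoot n)) ⟩
    coveredRoot n + withRoot n            ≡⟨ +-comm (coveredRoot n) (withRoot n) ⟩
    withRoot n + coveredRoot n            ∎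
    where open ≡-Reasoning

  d≡withRoot+withoutRoot : ∀ n → d n ≡ withRoot n + withoutRoot n
  d≡withRoot+withoutRoot n = begin
    length (filter (maximalIndependent? (D n)) (allSubsets (3 * n + 1)))
      ≡⟨ cong length (filter-≐ (maximalIndependent? (D n)) (T? ∘ isMISᵇ n false ∘ indicator)
           (to (mis⇔T _) , from (mis⇔T _)) (allSubsets (3 * n + 1))) ⟩
    length (filterᵇ (isMISᵇ n false ∘ indicator) (allSubsets (3 * n + 1)))
      ≡⟨ length-filterᵇ-allSubsets (3 * n + 1) (isMISᵇ n false) ⟩
    count (3 * n + 1) (isMISᵇ n false)
      ≡⟨ cong (λ m → count m (isMISᵇ n false)) (+-comm (3 * n) 1) ⟩
    withRoot n + withoutRoot n ∎
    where
    open ≡-Reasoning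
    mis⇔T : ∀ S → MaximalIndependent (D n) S ⇔ T (isMISᵇ n false (indicator S))
    mis⇔T S = ⇔-trans (maximalIndependent⇔isMISᵇ n S) (⇔-sym T-≡)

  module _ (x y z : ℕ → ℕ)
           (x-suc : ∀ n → x (suc n) ≡ x n + y n)
           (y-suc : ∀ n → y (suc n) ≡ z n)
           (z-suc : ∀ n → z (suc n) ≡ x n + z n) where

    x-recurrence : ∀ n → x (3 + n) + x (1 + n) ≡ 2 * x (2 + n) + x n
    x-recurrence n
      rewrite x-suc (2 + n) | y-suc (1 + n) | z-suc n | x-suc (1 + n) | y-suc n =
      identity (x (1 + n)) (z n) (x n)
      where
      identity : ∀ a b c → a + b + (c + b) + a ≡ 2 * (a + b) + c
      identity = ℕ-Solver.solve-∀

  d≡withRoot : ∀ n → d n ≡ withRoot (suc n)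
  d≡withRoot n = trans (d≡withRoot+withoutRoot n) (sym (withRoot-suc n))

  d-recurrence : ∀ n → d (3 + n) + d (1 + n) ≡ 2 * d (2 + n) + d n
  d-recurrence n = begin
    d (3 + n) + d (1 + n)                    ≡⟨ cong₂ _+_ (d≡withRoot (3 + n)) (d≡withRoot (1 + n)) ⟩
    withRoot (4 + n) + withRoot (2 + n)      ≡⟨ withRoot-recurrence (1 + n) ⟩
    2 * withRoot (3 + n) + withRoot (1 + n)  ≡⟨ cong₂ (λ p q → 2 * p + q) (d≡withRoot (2 + n)) (d≡withRoot n) ⟨
    2 * d (2 + n) + d n                      ∎
    where
    open ≡-Reasoning
    withRoot-recurrence : ∀ k → withRoot (3 + k) + withRoot (1 + k) ≡ 2 * withRoot (2 + k) + withRoot k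
    withRoot-recurrence = x-recurrence withRoot withoutRoot coveredRoot withRoot-suc withoutRoot-suc coveredRoot-suc

open import Data.Integer using (+_; _+_; _-_; _*_)

ℕ-recurrence⇒ℤ : ∀ a b c e → a ℕ.+ c ≡ 2 ℕ.* b ℕ.+ e → + a ≡ + 2 * + b - + c + + e
ℕ-recurrence⇒ℤ a b c e a+c≡2b+e = begin
  + a                      ≡⟨ add-sub (+ a) (+ c) ⟩
  + (a ℕ.+ c) - + c        ≡⟨ cong (λ t → + t - + c) a+c≡2b+e ⟩
  + (2 ℕ.* b) + + e - + c  ≡⟨ cong (λ t → t + + e - + c) (pos-* 2 b) ⟩
  + 2 * + b + + e - + c    ≡⟨ swap-sub (+ 2 * + b) (+ c) (+ e) ⟩
  + 2 * + b - + c + + e    ∎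
  where
  open ≡-Reasoning
  add-sub : ∀ i j → i ≡ i + j - j
  add-sub = ℤ-Solver.solve-∀
  swap-sub : ∀ i j k → i + k - j ≡ i - j + k
  swap-sub = ℤ-Solver.solve-∀

recurrence⇒ℤ : (f : ℕ → ℕ) → (∀ n → f (3 ℕ.+ n) ℕ.+ f (1 ℕ.+ n) ≡ 2 ℕ.* f (2 ℕ.+ n) ℕ.+ f n) →
  ∀ n → 3 ≤ n → + f n ≡ + 2 * + f (n ∸ 1) - + f (n ∸ 2) + + f (n ∸ 3)
recurrence⇒ℤ f rec (suc (suc (suc n))) (s≤s (s≤s (s≤s _))) =
  ℕ-recurrence⇒ℤ (f (3 ℕ.+ n)) (f (2 ℕ.+ n)) (f (1 ℕ.+ n)) (f n) (rec n)

theorem2p5 : (d 1 ≡ 2) × (d 2 ≡ 4) × (d 3 ≡ 7) ×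
    (∀ n → 4 ≤ n →
      + d n ≡ + 2 * + d (n ∸ 1) - + d (n ∸ 2) + + d (n ∸ 3))
-- The right-hand sides of the first three components evaluate to 2, 4 and 7.
theorem2p5 =
  d≡withRoot+withoutRoot 1 , d≡withRoot+withoutRoot 2 , d≡withRoot+withoutRoot 3 ,
  λ n 4≤n → recurrence⇒ℤ d d-recurrence n (<⇒≤ 4≤n)
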